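{- Let $A=[a_{ijk}]=[A_1,\dots,A_n]$ be an $n\times n\times n$ planar alternating sign hypermatrix (PASHM) and $L(A)=1A_1+2A_2+\cdots+nA_n=[l_{ij}]$. Then the sum of the entries in each row and each column of $L(A)$ equals $\binom{n+1}{2}$. If moreover $A$ is an ASHM, then: (i) the set of entries of $L(A)$ is $\{1,2,\dots,n\}$, and the first and last rows and columns of $L(A)$ are permutations of $1,2,\dots,n$; (ii) for $1\le i,j\le n$, let $a_{ijk}=\pm1$ exactly for $k\in\{k_1,\dots,k_p\}$, where $1\le p\le n$ and $1\le k_1<k_2<\cdots<k_p\le n$, and $a_{ijk}=0$ otherwise. Then (iia) if $l_{ij}=r$ then $k_1\le r$ and $|\{k:a_{ijk}\neq0\}|\le 2r-1$; moreover $k_1=r$ implies $p=1$. In particular, if $l_{ij}=1$ then $a_{ij1}=1$ and $a_{ijk}=0$ for $1<k\le n$; (iib) if $l_{ij}=r$ then $|\{k:a_{ijk}\neq0\}|\le 2(n-r)+1$. In particular, if $l_{ij}=n$ then $a_{ijn}=1$ and $a_{ijk}=0$ for $1\le k<n$.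
   Context: An $n\times n$ alternating sign matrix (ASM) is a $(0,\pm1)$-matrix whose rows and columns each have nonzeros alternating in sign beginning and ending with $+1$. For an $n\times n\times n$ $(0,\pm1)$-hypermatrix $A=[a_{ijk}]$, the horizontal planes are $A_k=[a_{ijk}]_{i,j}$ and we write $A=[A_1,\dots,A_n]$; its vertical lines are $(a_{ij1},\dots,a_{ijn})$. $A$ is a planar alternating sign hypermatrix (PASHM) if each $A_k$ is an ASM and each vertical line sums to $1$. $A$ is an alternating sign hypermatrix (ASHM) if every line (fix two of the three indices, vary the third) has nonzeros alternating in sign beginning and ending with $+1$. -}

module Defs where

open import Data.Nat using (ℕ; zero; suc; _<_)
open import Data.Fin using (Fin; toℕ)
open import Data.Integer using (ℤ; +_; -[1+_]; _+_; _*_; 0ℤ; 1ℤ; -1ℤ; _≟_)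
open import Data.List using (List; []; _∷_; tabulate; filter; length; foldr)
open import Data.List.Relation.Unary.All using (All)
open import Data.Sum using (_⊎_)
open import Data.Product using (_×_)
open import Relation.Binary.PropositionalEquality using (_≡_)
open import Relation.Nullary.Decidable using (¬?)
open import Data.Empty using (⊥)

sumℤ : List ℤ → ℤ
sumℤ = foldr _+_ 0ℤ

Is0±1 : ℤ → Set
Is0±1 x = x ≡ 0ℤ ⊎ x ≡ 1ℤ ⊎ x ≡ -1ℤ

nonzeros : List ℤ → List ℤ
nonzeros = filter (λ x → ¬? (x ≟ 0ℤ))

data AltPM : List ℤ → Set where
  one  : AltPM (1ℤ ∷ [])
  step : ∀ {xs} → AltPM xs → AltPM (1ℤ ∷ -1ℤ ∷ xs)

AltSignSeq : List ℤ → Set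
AltSignSeq xs = All Is0±1 xs × AltPM (nonzeros xs)

-- n×n matrices and n×n×n hypermatrices (0-based Fin indices); A i j k = a_{ijk}
Mat : ℕ → Set
Mat n = Fin n → Fin n → ℤ

Hyper : ℕ → Set
Hyper n = Fin n → Fin n → Fin n → ℤ

IsASM : (n : ℕ) → Mat n → Set
IsASM n M = (∀ i j → Is0±1 (M i j))
          × (∀ i → AltSignSeq (tabulate (λ j → M i j)))
          × (∀ j → AltSignSeq (tabulate (λ i → M i j)))

plane : ∀ {n} → Hyper n → Fin n → Mat n
plane A k i j = A i j k

vline : ∀ {n} → Hyper n → Fin n → Fin n → List ℤ
vline A i j = tabulate (λ k → A i j k)

IsPASHM : (n : ℕ) → Hyper n → Set
IsPASHM n A = (∀ i j k → Is0±1 (A i j k))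
            × (∀ k → IsASM n (plane A k))
            × (∀ i j → sumℤ (vline A i j) ≡ 1ℤ)

IsASHM : (n : ℕ) → Hyper n → Set
IsASHM n A = (∀ i j k → Is0±1 (A i j k))
           × (∀ j k → AltSignSeq (tabulate (λ i → A i j k)))
           × (∀ i k → AltSignSeq (tabulate (λ j → A i j k)))
           × (∀ i j → AltSignSeq (tabulate (λ k → A i j k)))

-- L(A) = 1 A_1 + 2 A_2 + ... + n A_n  (plane with 0-based index k has weight k+1)
L : ∀ {n} → Hyper n → Mat n
L A i j = sumℤ (tabulate (λ k → + suc (toℕ k) * A i j k))

nnz : ∀ {n} → Hyper n → Fin n → Fin n → ℕ
nnz A i j = length (nonzeros (vline A i j))

-- k (0-based) is the first index with a_{ijk} ≠ 0, i.e. k+1 = k_1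
IsFirstNonzero : ∀ {n} → Hyper n → Fin n → Fin n → Fin n → Set
IsFirstNonzero A i j k = (A i j k ≡ 0ℤ → ⊥) × (∀ k' → toℕ k' < toℕ k → A i j k' ≡ 0ℤ)

module Submission where

-- Row and column sums: exchanging the two summations, a row sum of L(A) is
-- Σ_k k·(row sum of A_k) = Σ_k k = C(n+1,2), since rows of an ASM sum to 1.
--
-- Part (ii) is a statement about one vertical line x_1,…,x_n, an alternating
-- sign sequence.  We describe such sequences by a two-state grammar (Alt⁺/Alt⁻)
-- and read off, along a derivation, the weight r = Σ_k k·x_k (= l_ij) and the
-- number m of entries −1 (there are 2m+1 nonzeros).  With k₁ the first nonzero
-- position we prove  k₁ + m ≤ r  and  r + m ≤ n;  (ii) and the bounds 1 ≤ l_ij ≤ n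
-- follow by arithmetic, and when m = 0 the line is a single +1 at position r.
--
-- Part (i): in a first or last row i, every vertical line avoids −1 (its entries
-- end lines of A), so it is a single +1; row i of A_k contains a +1, hence the
-- value k occurs in row i of L(A), and n distinct values 1,…,n form a permutation.

open import Defs
open import Data.Nat using (ℕ; zero; suc; _+_; _*_; _∸_; _≤_; _<_; z≤n; s≤s; s≤s⁻¹)
open import Data.Nat.Combinatorics using (_C_; nC1≡n; nCk+nC[k+1]≡[n+1]C[k+1])
open import Data.Nat.Tactic.RingSolver using (solve-∀)
import Data.Nat.Properties as ℕP
import Data.Fin.Properties as FinP
open import Data.Fin using (Fin; toℕ; zero; suc)
open import Data.Integer using (ℤ; +_; 0ℤ; 1ℤ; -1ℤ; +≤+)
  renaming (_≤_ to _≤ℤ_; _+_ to _+ℤ_; _*_ to _*ℤ_)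
import Data.Integer.Properties as ℤP
open import Data.List using (List; []; _∷_; _++_; length; tabulate)
open import Data.List.Properties using (tabulate-cong; length-tabulate)
open import Data.List.Relation.Unary.All using (All; []; _∷_)
import Data.List.Relation.Unary.All as All
import Data.List.Relation.Unary.All.Properties as AllP
open import Data.List.Relation.Unary.Any using (here; there)
open import Data.List.Relation.Unary.AllPairs using (_∷_)
open import Data.List.Relation.Unary.Unique.Propositional using (Unique)
import Data.List.Relation.Unary.Unique.Propositional.Properties as Unique
open import Data.List.Membership.Propositional using (_∈_)
open import Data.List.Membership.Propositional.Properties
  using (∈-∃++; ∈-tabulate⁺; ∈-tabulate⁻)
open import Data.List.Relation.Binary.Permutation.Propositional
  using (_↭_; ↭-refl; ↭-prep; ↭-sym; ↭-trans)
open import Data.List.Relation.Binary.Permutation.Propositional.Properties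
  using (shift; ∈-resp-↭; ↭-length)
open import Data.Product using (_×_; _,_; proj₁; proj₂; ∃; ∃₂)
open import Data.Sum using (_⊎_; inj₁; inj₂)
open import Data.Empty using (⊥-elim)
open import Relation.Nullary using (yes; no)
open import Relation.Binary.PropositionalEquality
  using (_≡_; _≢_; refl; sym; trans; cong; cong₂; subst; module ≡-Reasoning)
open import Algebra.Properties.CommutativeMonoid.Sum ℤP.+-0-commutativeMonoid
  using (∑-comm; ∑-distrib-+; sum-cong-≗) renaming (sum to ∑)
open import Algebra.Properties.Semiring.Sum ℤP.+-*-semiring using (*-distribˡ-sum)


sumℤ-tabulate : ∀ {n} (f : Fin n → ℤ) → sumℤ (tabulate f) ≡ ∑ f
sumℤ-tabulate {zero}  f = refl
sumℤ-tabulate {suc n} f = cong (f zero +ℤ_) (sumℤ-tabulate (λ k → f (suc k)))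

sumℤ-cong : ∀ {n} {f g : Fin n → ℤ} → (∀ k → f k ≡ g k) →
            sumℤ (tabulate f) ≡ sumℤ (tabulate g)
sumℤ-cong f≗g = cong sumℤ (tabulate-cong f≗g)

sumℤ-+ : ∀ {n} (f g : Fin n → ℤ) →
         sumℤ (tabulate (λ k → f k +ℤ g k)) ≡ sumℤ (tabulate f) +ℤ sumℤ (tabulate g)
sumℤ-+ f g = begin
  sumℤ (tabulate (λ k → f k +ℤ g k))  ≡⟨ sumℤ-tabulate (λ k → f k +ℤ g k) ⟩
  ∑ (λ k → f k +ℤ g k)                ≡⟨ ∑-distrib-+ f g ⟩
  ∑ f +ℤ ∑ g                          ≡⟨ sym (cong₂ _+ℤ_ (sumℤ-tabulate f) (sumℤ-tabulate g)) ⟩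
  sumℤ (tabulate f) +ℤ sumℤ (tabulate g) ∎
  where open ≡-Reasoning

sumℤ-scale : ∀ {n} c (f : Fin n → ℤ) →
             sumℤ (tabulate (λ k → c *ℤ f k)) ≡ c *ℤ sumℤ (tabulate f)
sumℤ-scale c f = begin
  sumℤ (tabulate (λ k → c *ℤ f k))  ≡⟨ sumℤ-tabulate (λ k → c *ℤ f k) ⟩
  ∑ (λ k → c *ℤ f k)                ≡⟨ sym (*-distribˡ-sum c f) ⟩
  c *ℤ ∑ f                          ≡⟨ cong (c *ℤ_) (sym (sumℤ-tabulate f)) ⟩
  c *ℤ sumℤ (tabulate f)            ∎
  where open ≡-Reasoning

sumℤ-swap : ∀ {m n} (g : Fin m → Fin n → ℤ) →
            sumℤ (tabulate (λ j → sumℤ (tabulate (g j)))) ≡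
            sumℤ (tabulate (λ k → sumℤ (tabulate (λ j → g j k))))
sumℤ-swap g = begin
  sumℤ (tabulate (λ j → sumℤ (tabulate (g j))))        ≡⟨ sumℤ-tabulate (λ j → sumℤ (tabulate (g j))) ⟩
  ∑ (λ j → sumℤ (tabulate (g j)))                      ≡⟨ sum-cong-≗ (λ j → sumℤ-tabulate (g j)) ⟩
  ∑ (λ j → ∑ (g j))                                    ≡⟨ ∑-comm g ⟩
  ∑ (λ k → ∑ (λ j → g j k))                            ≡⟨ sum-cong-≗ (λ k → sym (sumℤ-tabulate (λ j → g j k))) ⟩
  ∑ (λ k → sumℤ (tabulate (λ j → g j k)))              ≡⟨ sym (sumℤ-tabulate (λ k → sumℤ (tabulate (λ j → g j k)))) ⟩
  sumℤ (tabulate (λ k → sumℤ (tabulate (λ j → g j k)))) ∎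
  where open ≡-Reasoning

-- The weight Σ_k k·x_k of a sequence (positions counted from 1), computed by
-- peeling off the first entry: shifting all positions by one adds Σ_k x_k.
weight : List ℤ → ℤ
weight []       = 0ℤ
weight (x ∷ xs) = x +ℤ (sumℤ xs +ℤ weight xs)

weighted-sum : ∀ {n} (f : Fin n → ℤ) →
               sumℤ (tabulate (λ k → + suc (toℕ k) *ℤ f k)) ≡ weight (tabulate f)
weighted-sum {zero}  f = refl
weighted-sum {suc n} f = cong₂ _+ℤ_ (ℤP.*-identityˡ (f zero)) (begin
  sumℤ (tabulate (λ k → + suc (suc (toℕ k)) *ℤ g k))       ≡⟨ sumℤ-cong (λ k → shift-weight (toℕ k) (g k)) ⟩
  sumℤ (tabulate (λ k → g k +ℤ + suc (toℕ k) *ℤ g k))      ≡⟨ sumℤ-+ g _ ⟩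
  sumℤ (tabulate g) +ℤ sumℤ (tabulate (λ k → + suc (toℕ k) *ℤ g k))
                                                            ≡⟨ cong (sumℤ (tabulate g) +ℤ_) (weighted-sum g) ⟩
  sumℤ (tabulate g) +ℤ weight (tabulate g)                 ∎)
  where
  open ≡-Reasoning
  g : Fin n → ℤ
  g k = f (suc k)
  shift-weight : ∀ c x → + suc (suc c) *ℤ x ≡ x +ℤ + suc c *ℤ x
  shift-weight c x = trans (ℤP.*-distribʳ-+ x 1ℤ (+ suc c))
                           (cong (_+ℤ + suc c *ℤ x) (ℤP.*-identityˡ x))

triangular : ∀ n → weight (tabulate {n = n} (λ _ → 1ℤ)) ≡ + (suc n C 2)
triangular n = proj₂ (ones n)
  where
  ones : ∀ n → sumℤ (tabulate {n = n} (λ _ → 1ℤ)) ≡ + n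
             × weight (tabulate {n = n} (λ _ → 1ℤ)) ≡ + (suc n C 2)
  ones zero    = refl , refl
  ones (suc n) with ones n
  ... | sum≡n , weight≡C = cong (1ℤ +ℤ_) sum≡n ,
    (begin
      1ℤ +ℤ (sumℤ ones′ +ℤ weight ones′)  ≡⟨ cong (λ z → 1ℤ +ℤ z) (cong₂ _+ℤ_ sum≡n weight≡C) ⟩
      + (suc n + suc n C 2)              ≡⟨ cong (λ z → + (z + suc n C 2)) (sym (nC1≡n (suc n))) ⟩
      + (suc n C 1 + suc n C 2)          ≡⟨ cong +_ (nCk+nC[k+1]≡[n+1]C[k+1] (suc n) 1) ⟩
      + (suc (suc n) C 2)                ∎)
    where
    open ≡-Reasoning
    ones′ : List ℤ
    ones′ = tabulate {n = n} (λ _ → 1ℤ)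

weighted-layer-sum : ∀ {m n} (g : Fin m → Fin n → ℤ) →
  (∀ k → sumℤ (tabulate (λ j → g j k)) ≡ 1ℤ) →
  sumℤ (tabulate (λ j → sumℤ (tabulate (λ k → + suc (toℕ k) *ℤ g j k)))) ≡ + (suc n C 2)
weighted-layer-sum {n = n} g layer = begin
  sumℤ (tabulate (λ j → sumℤ (tabulate (λ k → c k *ℤ g j k))))  ≡⟨ sumℤ-swap (λ j k → c k *ℤ g j k) ⟩
  sumℤ (tabulate (λ k → sumℤ (tabulate (λ j → c k *ℤ g j k))))  ≡⟨ sumℤ-cong column ⟩
  sumℤ (tabulate (λ k → c k *ℤ 1ℤ))                            ≡⟨ weighted-sum {n} (λ _ → 1ℤ) ⟩
  weight (tabulate {n = n} (λ _ → 1ℤ))                          ≡⟨ triangular n ⟩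
  + (suc n C 2)                                                ∎
  where
  open ≡-Reasoning
  c : Fin n → ℤ
  c k = + suc (toℕ k)
  column : ∀ k → sumℤ (tabulate (λ j → c k *ℤ g j k)) ≡ c k *ℤ 1ℤ
  column k = trans (sumℤ-scale (c k) (λ j → g j k)) (cong (c k *ℤ_) (layer k))

-- Alt⁺ xs: the
-- nonzeros of xs are +1,−1,…,+1 (what AltSignSeq asks for); Alt⁻ xs: they
-- are −1,+1,…,+1 or there are none (what may follow a +1).  Entries are given
-- by equations rather than by indices so that the grammar can also be matched
-- against tabulate f, whose entries f k are not constructor forms.
data Alt⁺ : List ℤ → Set
data Alt⁻ : List ℤ → Set

data Alt⁺ where
  skip : ∀ {x xs} → x ≡ 0ℤ → Alt⁺ xs → Alt⁺ (x ∷ xs)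
  plus : ∀ {x xs} → x ≡ 1ℤ → Alt⁻ xs → Alt⁺ (x ∷ xs)

data Alt⁻ where
  done  : Alt⁻ []
  skip  : ∀ {x xs} → x ≡ 0ℤ → Alt⁻ xs → Alt⁻ (x ∷ xs)
  minus : ∀ {x xs} → x ≡ -1ℤ → Alt⁺ xs → Alt⁻ (x ∷ xs)

data AltPM⁻ : List ℤ → Set where
  none  : AltPM⁻ []
  minus : ∀ {zs} → AltPM zs → AltPM⁻ (-1ℤ ∷ zs)

after-plus : ∀ {ys} → AltPM (1ℤ ∷ ys) → AltPM⁻ ys
after-plus one      = none
after-plus (step p) = minus p

toAlt⁺ : ∀ {xs} → All Is0±1 xs → AltPM (nonzeros xs) → Alt⁺ xs
toAlt⁻ : ∀ {xs} → All Is0±1 xs → AltPM⁻ (nonzeros xs) → Alt⁻ xs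
toAlt⁺ (inj₁ refl        ∷ xs±) p = skip refl (toAlt⁺ xs± p)
toAlt⁺ (inj₂ (inj₁ refl) ∷ xs±) p = plus refl (toAlt⁻ xs± (after-plus p))
toAlt⁺ (inj₂ (inj₂ refl) ∷ xs±) ()
toAlt⁻ []                        none      = done
toAlt⁻ (inj₁ refl        ∷ xs±) p         = skip refl (toAlt⁻ xs± p)
toAlt⁻ (inj₂ (inj₁ refl) ∷ xs±) ()
toAlt⁻ (inj₂ (inj₂ refl) ∷ xs±) (minus p) = minus refl (toAlt⁺ xs± p)

alt : ∀ {xs} → AltSignSeq xs → Alt⁺ xs
alt (xs± , p) = toAlt⁺ xs± p

sum⁺ : ∀ {xs} → Alt⁺ xs → sumℤ xs ≡ 1ℤ
sum⁻ : ∀ {xs} → Alt⁻ xs → sumℤ xs ≡ 0ℤ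
sum⁺ (skip refl h)  = trans (ℤP.+-identityˡ _) (sum⁺ h)
sum⁺ (plus refl h)  = cong (1ℤ +ℤ_) (sum⁻ h)
sum⁻ done           = refl
sum⁻ (skip refl h)  = trans (ℤP.+-identityˡ _) (sum⁻ h)
sum⁻ (minus refl h) = cong (-1ℤ +ℤ_) (sum⁺ h)

-- The weight Σ_k k·x_k of an alternating sequence, computed as a natural number
-- along the derivation (see weight≡rank⁺): a 0 or +1 shifts the rest one place.
rank⁺ : ∀ {xs} → Alt⁺ xs → ℕ
rank⁻ : ∀ {xs} → Alt⁻ xs → ℕ
rank⁺ (skip _ h)  = suc (rank⁺ h)
rank⁺ (plus _ h)  = suc (rank⁻ h)
rank⁻ done        = 0
rank⁻ (skip _ h)  = rank⁻ h
rank⁻ (minus _ h) = rank⁺ h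

minuses⁺ : ∀ {xs} → Alt⁺ xs → ℕ
minuses⁻ : ∀ {xs} → Alt⁻ xs → ℕ
minuses⁺ (skip _ h)  = minuses⁺ h
minuses⁺ (plus _ h)  = minuses⁻ h
minuses⁻ done        = 0
minuses⁻ (skip _ h)  = minuses⁻ h
minuses⁻ (minus _ h) = suc (minuses⁺ h)

-- The recursion weight (x ∷ xs) = x + Σ xs + weight xs, with Σ xs ∈ {0,1} known.
weight≡rank⁺ : ∀ {xs} (h : Alt⁺ xs) → weight xs ≡ + rank⁺ h
weight≡rank⁻ : ∀ {xs} (h : Alt⁻ xs) → weight xs ≡ + rank⁻ h
weight≡rank⁺ (skip refl h) = trans (ℤP.+-identityˡ _) (cong₂ _+ℤ_ (sum⁺ h) (weight≡rank⁺ h))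
weight≡rank⁺ (plus refl h) = cong (1ℤ +ℤ_) (cong₂ _+ℤ_ (sum⁻ h) (weight≡rank⁻ h))
weight≡rank⁻ done           = refl
weight≡rank⁻ (skip refl h)  = trans (ℤP.+-identityˡ _) (cong₂ _+ℤ_ (sum⁻ h) (weight≡rank⁻ h))
weight≡rank⁻ (minus refl h) = cong (-1ℤ +ℤ_) (cong₂ _+ℤ_ (sum⁺ h) (weight≡rank⁺ h))

count : List ℤ → ℕ
count xs = length (nonzeros xs)

count⁺ : ∀ {xs} (h : Alt⁺ xs) → count xs ≡ suc (2 * minuses⁺ h)
count⁻ : ∀ {xs} (h : Alt⁻ xs) → count xs ≡ 2 * minuses⁻ h
count⁺ (skip refl h)  = count⁺ h
count⁺ (plus refl h)  = cong suc (count⁻ h)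
count⁻ done           = refl
count⁻ (skip refl h)  = count⁻ h
count⁻ (minus refl h) = trans (cong suc (count⁺ h)) (sym (ℕP.*-suc 2 (minuses⁺ h)))

data FirstNonzeroAt : List ℤ → ℕ → Set where
  at-head    : ∀ {x xs} → x ≢ 0ℤ → FirstNonzeroAt (x ∷ xs) 0
  after-zero : ∀ {x xs t} → x ≡ 0ℤ → FirstNonzeroAt xs t → FirstNonzeroAt (x ∷ xs) (suc t)

-- Each −1 is preceded by a +1 of larger weight: m < r (m ≤ r after a +1).
minuses<rank⁺ : ∀ {xs} (h : Alt⁺ xs) → minuses⁺ h < rank⁺ h
minuses≤rank⁻ : ∀ {xs} (h : Alt⁻ xs) → minuses⁻ h ≤ rank⁻ h
minuses<rank⁺ (skip _ h)  = ℕP.m<n⇒m<1+n (minuses<rank⁺ h)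
minuses<rank⁺ (plus _ h)  = s≤s (minuses≤rank⁻ h)
minuses≤rank⁻ done        = z≤n
minuses≤rank⁻ (skip _ h)  = minuses≤rank⁻ h
minuses≤rank⁻ (minus _ h) = minuses<rank⁺ h

-- Front bound: if the first nonzero is at position t (0-based), then t + m < r,
-- i.e. k₁ + m ≤ r for the 1-based position k₁ = t + 1.
first-bound : ∀ {xs t} (h : Alt⁺ xs) → FirstNonzeroAt xs t → t + minuses⁺ h < rank⁺ h
first-bound (skip refl h) (at-head 0≢0)     = ⊥-elim (0≢0 refl)
first-bound (skip _ h)    (after-zero _ ft) = s≤s (first-bound h ft)
first-bound (plus _ h)    (at-head _)       = s≤s (minuses≤rank⁻ h)
first-bound (plus refl h) (after-zero () _)

back-bound⁺ : ∀ {xs} (h : Alt⁺ xs) → rank⁺ h + minuses⁺ h ≤ length xs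
back-bound⁻ : ∀ {xs} (h : Alt⁻ xs) → rank⁻ h + minuses⁻ h ≤ length xs
back-bound⁺ (skip _ h)  = s≤s (back-bound⁺ h)
back-bound⁺ (plus _ h)  = s≤s (back-bound⁻ h)
back-bound⁻ done        = z≤n
back-bound⁻ (skip _ h)  = ℕP.m≤n⇒m≤1+n (back-bound⁻ h)
back-bound⁻ {_ ∷ xs} (minus _ h) =
  subst (_≤ suc (length xs)) (sym (ℕP.+-suc (rank⁺ h) (minuses⁺ h))) (s≤s (back-bound⁺ h))

back-bound : ∀ {n} {f : Fin n → ℤ} (h : Alt⁺ (tabulate f)) → rank⁺ h + minuses⁺ h ≤ n
back-bound {f = f} h = subst (rank⁺ h + minuses⁺ h ≤_) (length-tabulate f) (back-bound⁺ h)

zeros⁻ : ∀ {xs} (h : Alt⁻ xs) → minuses⁻ h ≡ 0 → All (_≡ 0ℤ) xs × rank⁻ h ≡ 0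
zeros⁻ done         _   = [] , refl
zeros⁻ (skip x≡0 h) m≡0 = (x≡0 ∷ proj₁ (zeros⁻ h m≡0)) , proj₂ (zeros⁻ h m≡0)
zeros⁻ (minus _ h)  ()

no-minus⁺ : ∀ {xs} (h : Alt⁺ xs) → All (_≢ -1ℤ) xs → minuses⁺ h ≡ 0
no-minus⁻ : ∀ {xs} (h : Alt⁻ xs) → All (_≢ -1ℤ) xs → minuses⁻ h ≡ 0
no-minus⁺ (skip _ h)     (_ ∷ ok)  = no-minus⁺ h ok
no-minus⁺ (plus _ h)     (_ ∷ ok)  = no-minus⁻ h ok
no-minus⁻ done           []        = refl
no-minus⁻ (skip _ h)     (_ ∷ ok)  = no-minus⁻ h ok
no-minus⁻ (minus refl h) (ok ∷ _)  = ⊥-elim (ok refl)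

FirstNonzero : ∀ {n} → (Fin n → ℤ) → Fin n → Set
FirstNonzero f k = (f k ≢ 0ℤ) × (∀ k′ → toℕ k′ < toℕ k → f k′ ≡ 0ℤ)

first-nonzero-at : ∀ {n} {f : Fin n → ℤ} k → FirstNonzero f k →
                   FirstNonzeroAt (tabulate f) (toℕ k)
first-nonzero-at zero    (fk≢0 , _)      = at-head fk≢0
first-nonzero-at (suc k) (fk≢0 , before) =
  after-zero (before zero (s≤s z≤n))
        (first-nonzero-at k (fk≢0 , λ k′ k′<k → before (suc k′) (s≤s k′<k)))

rank⁺≢0 : ∀ {xs} (h : Alt⁺ xs) → rank⁺ h ≢ 0
rank⁺≢0 (skip _ _) ()
rank⁺≢0 (plus _ _) ()

single-entries : ∀ {n} {f : Fin n → ℤ} (h : Alt⁺ (tabulate f)) → minuses⁺ h ≡ 0 → ∀ k →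
                 (suc (toℕ k) ≡ rank⁺ h → f k ≡ 1ℤ) × (suc (toℕ k) ≢ rank⁺ h → f k ≡ 0ℤ)
single-entries {suc n} (skip f0≡0 h) m≡0 zero =
  (λ 1≡r → ⊥-elim (rank⁺≢0 h (sym (ℕP.suc-injective 1≡r)))) , (λ _ → f0≡0)
single-entries {suc n} (skip _ h) m≡0 (suc k) with single-entries h m≡0 k
... | is-one , is-zero = (λ eq → is-one (ℕP.suc-injective eq)) , (λ ne → is-zero (λ eq → ne (cong suc eq)))
single-entries {suc n} (plus f0≡1 h) m≡0 zero =
  (λ _ → f0≡1) , (λ 1≢r → ⊥-elim (1≢r (cong suc (sym (proj₂ (zeros⁻ h m≡0))))))
single-entries {suc n} (plus _ h) m≡0 (suc k) with zeros⁻ h m≡0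
... | rest≡0 , r≡0 = (λ eq → ⊥-elim (0≢suc (trans (sym r≡0) (sym (ℕP.suc-injective eq))))) ,
                     (λ _ → AllP.tabulate⁻ rest≡0 k)
  where
  0≢suc : ∀ {m} → 0 ≢ suc m
  0≢suc ()

SingleAt : ∀ {n} → (Fin n → ℤ) → ℕ → Set
SingleAt f t = ∀ k → (toℕ k ≡ t → f k ≡ 1ℤ) × (toℕ k ≢ t → f k ≡ 0ℤ)

single-entries-at : ∀ {n} {f : Fin n → ℤ} (h : Alt⁺ (tabulate f)) → minuses⁺ h ≡ 0 →
                    ∀ {t} → suc t ≡ rank⁺ h → SingleAt f t
single-entries-at h m≡0 t+1≡r k with single-entries h m≡0 k
... | is-one , is-zero =
  (λ k≡t → is-one (trans (cong suc k≡t) t+1≡r)) ,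
  (λ k≢t → is-zero (λ eq → k≢t (ℕP.suc-injective (trans eq (sym t+1≡r)))))

has-one : ∀ {n} {f : Fin n → ℤ} → Alt⁺ (tabulate f) → ∃ λ k → f k ≡ 1ℤ
has-one {suc n} (skip _ h)    = let (k , fk≡1) = has-one h in suc k , fk≡1
has-one {suc n} (plus f0≡1 _) = zero , f0≡1

first-not-minus : ∀ {x xs} → Alt⁺ (x ∷ xs) → x ≢ -1ℤ
first-not-minus (skip refl _) ()
first-not-minus (plus refl _) ()

last-not-minus⁺ : ∀ {n} {f : Fin n → ℤ} → Alt⁺ (tabulate f) → ∀ i → suc (toℕ i) ≡ n → f i ≢ -1ℤ
last-not-minus⁻ : ∀ {n} {f : Fin n → ℤ} → Alt⁻ (tabulate f) → ∀ i → suc (toℕ i) ≡ n → f i ≢ -1ℤ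
last-not-minus⁺ h           zero    _  = first-not-minus h
last-not-minus⁺ (skip _ h)  (suc i) eq = last-not-minus⁺ h i (ℕP.suc-injective eq)
last-not-minus⁺ (plus _ h)  (suc i) eq = last-not-minus⁻ h i (ℕP.suc-injective eq)
last-not-minus⁻ (skip f0≡0 _) zero    _    = λ f0≡-1 → 0≢-1 (trans (sym f0≡0) f0≡-1)
  where
  0≢-1 : 0ℤ ≢ -1ℤ
  0≢-1 ()
last-not-minus⁻ {suc zero} (minus _ ()) zero refl
last-not-minus⁻ (skip _ h)  (suc i) eq = last-not-minus⁻ h i (ℕP.suc-injective eq)
last-not-minus⁻ (minus _ h) (suc i) eq = last-not-minus⁺ h i (ℕP.suc-injective eq)

Boundary : ∀ {n} → Fin n → Set
Boundary {n} i = toℕ i ≡ 0 ⊎ toℕ i ≡ n ∸ 1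

boundary-not-minus : ∀ {n} {f : Fin n → ℤ} → Alt⁺ (tabulate f) → ∀ i → Boundary i → f i ≢ -1ℤ
boundary-not-minus h zero    (inj₁ _)  = first-not-minus h
boundary-not-minus h (suc i) (inj₁ ())
boundary-not-minus {suc n} {f} h i (inj₂ i≡n-1) = last-not-minus⁺ {f = f} h i (cong suc i≡n-1)

odd-below : ∀ {m r} → m < r → suc (2 * m) ≤ 2 * r ∸ 1
odd-below {m} {r} m<r = ℕP.m+n≤o⇒m≤o∸n (suc (2 * m)) (subst (_≤ 2 * r) (double-suc m) (ℕP.*-monoʳ-≤ 2 m<r))
  where
  double-suc : ∀ m → 2 * suc m ≡ suc (2 * m) + 1
  double-suc = solve-∀

odd-bound : ∀ {m d} → m ≤ d → suc (2 * m) ≤ 2 * d + 1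
odd-bound {m} {d} m≤d = subst (_≤ 2 * d + 1) (ℕP.+-comm (2 * m) 1) (ℕP.+-monoˡ-≤ 1 (ℕP.*-monoʳ-≤ 2 m≤d))

no-room : ∀ a {m} → a + m ≤ a → m ≡ 0
no-room a {m} a+m≤a = ℕP.n≤0⇒n≡0 (ℕP.+-cancelˡ-≤ a m 0 (subst (a + m ≤_) (sym (ℕP.+-identityʳ a)) a+m≤a))

suc-n∸1 : ∀ {n} → Fin n → suc (n ∸ 1) ≡ n
suc-n∸1 {suc n} _ = refl

-- Part (ii) of the lemma for one line f of weight r, with p = count (tabulate f)
-- its number of nonzeros: (iia) and (iib).
LineFacts : (n : ℕ) → (Fin n → ℤ) → ℕ → Set
LineFacts n f r =
  ((∀ k → FirstNonzero f k → suc (toℕ k) ≤ r)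
   × count (tabulate f) ≤ 2 * r ∸ 1
   × (∀ k → FirstNonzero f k → suc (toℕ k) ≡ r → count (tabulate f) ≡ 1)
   × (r ≡ 1 → SingleAt f 0))
  × (count (tabulate f) ≤ 2 * (n ∸ r) + 1
     × (r ≡ n → SingleAt f (n ∸ 1)))

line-facts : ∀ {n} {f : Fin n → ℤ} (h : Alt⁺ (tabulate f)) → LineFacts n f (rank⁺ h)
line-facts {n} {f} h = (k₁≤r , p≤2r-1 , k₁≡r⇒p≡1 , r≡1⇒single) , (p≤2[n-r]+1 , r≡n⇒single)
  where
  r m p : ℕ
  r = rank⁺ h
  m = minuses⁺ h
  p = count (tabulate f)
  front : ∀ k → FirstNonzero f k → toℕ k + m < r
  front k first = first-bound h (first-nonzero-at k first)
  back : r + m ≤ n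
  back = back-bound h
  one-nonzero : m ≡ 0 → p ≡ 1
  one-nonzero m≡0 = trans (count⁺ h) (cong (λ x → suc (2 * x)) m≡0)

  k₁≤r : ∀ k → FirstNonzero f k → suc (toℕ k) ≤ r
  k₁≤r k first = ℕP.m+n≤o⇒m≤o (suc (toℕ k)) (front k first)
  p≤2r-1 : p ≤ 2 * r ∸ 1
  p≤2r-1 = subst (_≤ 2 * r ∸ 1) (sym (count⁺ h)) (odd-below (minuses<rank⁺ h))
  k₁≡r⇒p≡1 : ∀ k → FirstNonzero f k → suc (toℕ k) ≡ r → p ≡ 1
  k₁≡r⇒p≡1 k first k₁≡r =
    one-nonzero (no-room (toℕ k) (s≤s⁻¹ (subst (toℕ k + m <_) (sym k₁≡r) (front k first))))
  r≡1⇒single : r ≡ 1 → SingleAt f 0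
  r≡1⇒single r≡1 =
    single-entries-at h (ℕP.n<1⇒n≡0 (subst (m <_) r≡1 (minuses<rank⁺ h))) (sym r≡1)
  p≤2[n-r]+1 : p ≤ 2 * (n ∸ r) + 1
  p≤2[n-r]+1 = subst (_≤ 2 * (n ∸ r) + 1) (sym (count⁺ h))
                       (odd-bound (ℕP.m+n≤o⇒m≤o∸n m (subst (_≤ n) (ℕP.+-comm r m) back)))
  r≡n⇒single : r ≡ n → SingleAt f (n ∸ 1)
  r≡n⇒single r≡n k =
    single-entries-at h (no-room n (subst (λ s → s + m ≤ n) r≡n back)) (trans (suc-n∸1 k) (sym r≡n)) k

rank-bounds : ∀ {n} {f : Fin n → ℤ} (h : Alt⁺ (tabulate f)) → 1 ≤ rank⁺ h × rank⁺ h ≤ n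
rank-bounds h = ℕP.n≢0⇒n>0 (rank⁺≢0 h) , ℕP.m+n≤o⇒m≤o (rank⁺ h) (back-bound h)

isolated-one-rank : ∀ {n} {f : Fin n → ℤ} (h : Alt⁺ (tabulate f)) → All (_≢ -1ℤ) (tabulate f) →
                    ∀ {k} → f k ≡ 1ℤ → rank⁺ h ≡ suc (toℕ k)
isolated-one-rank h no-minus {k} fk≡1 with suc (toℕ k) ℕP.≟ rank⁺ h
... | yes k+1≡r = sym k+1≡r
... | no  k+1≢r = ⊥-elim (1≢0 (trans (sym fk≡1) (proj₂ (single-entries h (no-minus⁺ h no-minus) k) k+1≢r)))
  where
  1≢0 : 1ℤ ≢ 0ℤ
  1≢0 ()

unique-⊆⇒↭ : ∀ {X : Set} (xs ys : List X) → Unique xs → (∀ {z} → z ∈ xs → z ∈ ys) →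
             length xs ≡ length ys → xs ↭ ys
unique-⊆⇒↭ []       []       _          _  _   = ↭-refl
unique-⊆⇒↭ []       (_ ∷ _)  _          _  ()
unique-⊆⇒↭ (x ∷ xs) ys       (x∉xs ∷ u) xs⊆ys len with ∈-∃++ (xs⊆ys (here refl))
... | us , vs , refl = ↭-trans (↭-prep x (unique-⊆⇒↭ xs (us ++ vs) u xs⊆us++vs len′)) (↭-sym x-moved)
  where
  x-moved : us ++ (x ∷ []) ++ vs ↭ x ∷ us ++ vs
  x-moved = shift x us vs
  xs⊆us++vs : ∀ {z} → z ∈ xs → z ∈ us ++ vs
  xs⊆us++vs z∈xs with ∈-resp-↭ x-moved (xs⊆ys (there z∈xs))
  ... | here z≡x = ⊥-elim (All.lookup x∉xs z∈xs (sym z≡x))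
  ... | there z∈us++vs = z∈us++vs
  len′ : length xs ≡ length (us ++ vs)
  len′ = ℕP.suc-injective (trans len (↭-length x-moved))

values-↭ : ∀ {n} (g : Fin n → ℤ) → (∀ r → ∃ λ j → g j ≡ + suc (toℕ r)) →
           tabulate g ↭ tabulate (λ (r : Fin n) → + suc (toℕ r))
values-↭ {n} g takes = ↭-sym (unique-⊆⇒↭ (tabulate value) (tabulate g) distinct covered
                            (trans (length-tabulate value) (sym (length-tabulate g))))
  where
  value : Fin n → ℤ
  value r = + suc (toℕ r)
  distinct : Unique (tabulate value)
  distinct = Unique.tabulate⁺ (λ eq → FinP.toℕ-injective (ℕP.suc-injective (ℤP.+-injective eq)))
  covered : ∀ {z} → z ∈ tabulate value → z ∈ tabulate g
  covered z∈ with ∈-tabulate⁻ {f = value} z∈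
  ... | r , refl with takes r
  ...   | j , gj≡r = subst (_∈ tabulate g) gj≡r (∈-tabulate⁺ j)

vertical : ∀ {n} {A : Hyper n} → IsASHM n A → ∀ i j → Alt⁺ (vline A i j)
vertical (_ , _ , _ , lines) i j = alt (lines i j)

L≡rank : ∀ {n} {A : Hyper n} (ash : IsASHM n A) → ∀ i j → L A i j ≡ + rank⁺ (vertical ash i j)
L≡rank {A = A} ash i j = trans (weighted-sum (A i j)) (weight≡rank⁺ (vertical ash i j))

-- In a first or last row i of L(A) every value 1,…,n occurs: row i of the plane
-- A_k has a +1 at some j, and the vertical line at (i,j) avoids −1 because each
-- of its entries ends a line of the hypermatrix.
boundary-row-values : ∀ {n} {A : Hyper n} (ash : IsASHM n A) → ∀ i → Boundary i →
                      ∀ k → ∃ λ j → L A i j ≡ + suc (toℕ k)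
boundary-row-values {A = A} ash@(_ , cols , rows , _) i i-end k with has-one (alt (rows i k))
... | j , a≡1 = j , trans (L≡rank ash i j) (cong +_ (isolated-one-rank (vertical ash i j) no-minus a≡1))
  where
  no-minus : All (_≢ -1ℤ) (vline A i j)
  no-minus = AllP.tabulate⁺ (λ k′ → boundary-not-minus (alt (cols j k′)) i i-end)

boundary-col-values : ∀ {n} {A : Hyper n} (ash : IsASHM n A) → ∀ j → Boundary j →
                      ∀ k → ∃ λ i → L A i j ≡ + suc (toℕ k)
boundary-col-values {A = A} ash@(_ , cols , rows , _) j j-end k with has-one (alt (cols j k))
... | i , a≡1 = i , trans (L≡rank ash i j) (cong +_ (isolated-one-rank (vertical ash i j) no-minus a≡1))
  where
  no-minus : All (_≢ -1ℤ) (vline A i j)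
  no-minus = AllP.tabulate⁺ (λ k′ → boundary-not-minus (alt (rows i k′)) j j-end)

first-index : ∀ {n} → Fin n → ∃ λ (i : Fin n) → toℕ i ≡ 0
first-index zero    = zero , refl
first-index (suc _) = zero , refl

lemma3p1 : (n : ℕ) (A : Hyper n) → IsPASHM n A →
  ((∀ i → sumℤ (tabulate (λ j → L A i j)) ≡ + (suc n C 2))
   × (∀ j → sumℤ (tabulate (λ i → L A i j)) ≡ + (suc n C 2)))
  × (IsASHM n A →
    -- (i)
    (((∀ i j → (+ 1 ≤ℤ L A i j) × (L A i j ≤ℤ + n))
      × (∀ (r : Fin n) → ∃₂ λ i j → L A i j ≡ + suc (toℕ r)))
     × (∀ i → (toℕ i ≡ 0 ⊎ toℕ i ≡ n ∸ 1) →
          tabulate (λ j → L A i j) ↭ tabulate (λ (r : Fin n) → + suc (toℕ r)))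
     × (∀ j → (toℕ j ≡ 0 ⊎ toℕ j ≡ n ∸ 1) →
          tabulate (λ i → L A i j) ↭ tabulate (λ (r : Fin n) → + suc (toℕ r))))
    -- (ii)
    × (∀ i j (r : ℕ) → L A i j ≡ + r →
        -- (iia)
        ((∀ k → IsFirstNonzero A i j k → suc (toℕ k) ≤ r)
         × nnz A i j ≤ 2 * r ∸ 1
         × (∀ k → IsFirstNonzero A i j k → suc (toℕ k) ≡ r → nnz A i j ≡ 1)
         × (r ≡ 1 → ∀ k → (toℕ k ≡ 0 → A i j k ≡ 1ℤ) × (toℕ k ≢ 0 → A i j k ≡ 0ℤ)))
        -- (iib)
        × (nnz A i j ≤ 2 * (n ∸ r) + 1
           × (r ≡ n → ∀ k → (toℕ k ≡ n ∸ 1 → A i j k ≡ 1ℤ)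
                           × (toℕ k ≢ n ∸ 1 → A i j k ≡ 0ℤ)))))
lemma3p1 n A (_ , planes , _) =
  ( (λ i → weighted-layer-sum (λ j k → A i j k) (λ k → sum⁺ (alt (proj₁ (proj₂ (planes k)) i))))
  , (λ j → weighted-layer-sum (λ i k → A i j k) (λ k → sum⁺ (alt (proj₂ (proj₂ (planes k)) j)))) )
  , λ ash →
    ( ( (λ i j → subst (λ l → (+ 1 ≤ℤ l) × (l ≤ℤ + n)) (sym (L≡rank ash i j))
                       (let (1≤r , r≤n) = rank-bounds (vertical ash i j) in +≤+ 1≤r , +≤+ r≤n))
      , (λ r → let (i , i≡0) = first-index r
                   (j , lij≡r) = boundary-row-values ash i (inj₁ i≡0) r
               in i , j , lij≡r) )
    , (λ i i-end → values-↭ (λ j → L A i j) (boundary-row-values ash i i-end))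
    , (λ j j-end → values-↭ (λ i → L A i j) (boundary-col-values ash j j-end)) )
    , λ i j r lij≡r →
        subst (LineFacts n (A i j)) (ℤP.+-injective (trans (sym (L≡rank ash i j)) lij≡r))
              (line-facts (vertical ash i j))
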